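{- Let $\mathbf{P}$ be an integral partially ordered monoid and let $D\subseteq P$ be a nonempty set such that $a\backslash_{\mathcal{L}(\mathbf{P})} b\in D$ and $b/_{\mathcal{L}(\mathbf{P})} a\in D$ for all $a\in P$ and $b\in D$. Then $\overline{D}=\{\bigcap X\mid X\subseteq D\}$ (with $\bigcap\emptyset=P$), the closure system of $\mathcal{L}(\mathbf{P})$ generated by $D$, is a nucleus-system of $\mathcal{L}(\mathbf{P})$. In particular, $\overline{D}$ is a residuated lattice with meet $\cap$, join $x\vee y=\gamma(x\cup y)$, multiplication $x\circ_{\overline{D}}y=\gamma(x\circ y)$, the residuals of $\mathcal{L}(\mathbf{P})$ restricted to $\overline{D}$, and unit $\gamma({\downarrow}1)$, where $\gamma(a)=\bigcap\{d\in D\mid a\subseteq d\}$.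
   Context: A partially ordered monoid is a monoid with a partial order such that multiplication is order-preserving in each argument; it is integral if $1$ is the greatest element. $\mathcal{L}(\mathbf{P})$ is the set of order-ideals (down-sets) of $\mathbf{P}$, ordered by inclusion, with each $p\in P$ identified with ${\downarrow}p$ (so $P\subseteq\mathcal{L}(\mathbf{P})$); it is a residuated lattice with $\cap,\cup$, product $X\circ Y={\downarrow}\{xy\mid x\in X,y\in Y\}$, residuals $X\backslash Y=\{z\mid xz\in Y\ \forall x\in X\}$, $Y/X=\{z\mid zx\in Y\ \forall x\in X\}$, unit ${\downarrow}1=P$. A nucleus-system of a residuated lattice $\mathbf{K}$ is a subset $C$ such that $\min\{c\in C\mid x\le c\}$ exists for every $x\in K$ and $x\backslash a, a/x\in C$ for all $x\in K$, $a\in C$. -}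

module Defs where

open import Level using (Level; _⊔_; suc)
open import Data.Product using (Σ; Σ-syntax; ∃; _×_; _,_)
open import Relation.Binary.PropositionalEquality using (_≡_)
open import Relation.Binary.Core using (Rel)
open import Relation.Binary.Structures using (IsPartialOrder)
open import Algebra.Core using (Op₂)
open import Algebra.Structures using (IsMonoid)

record Pomonoid (c ℓ : Level) : Set (suc (c ⊔ ℓ)) where
  infix  4 _≤_
  infixl 7 _∙_
  field
    Carrier        : Set c
    _≤_            : Rel Carrier ℓ
    _∙_            : Op₂ Carrier
    ε              : Carrier
    isPartialOrder : IsPartialOrder _≡_ _≤_
    isMonoid       : IsMonoid _≡_ _∙_ ε
    ∙-monoˡ        : ∀ {x y} z → x ≤ y → x ∙ z ≤ y ∙ z
    ∙-monoʳ        : ∀ {x y} z → x ≤ y → z ∙ x ≤ z ∙ y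

IsIntegral : ∀ {c ℓ} → Pomonoid c ℓ → Set (c ⊔ ℓ)
IsIntegral P = ∀ x → x ≤ ε
  where open Pomonoid P

module LP {c ℓ : Level} (P : Pomonoid c ℓ) where
  open Pomonoid P

  Subset : Set (suc (c ⊔ ℓ))
  Subset = Carrier → Set (c ⊔ ℓ)

  _⊆_ : Subset → Subset → Set (c ⊔ ℓ)
  X ⊆ Y = ∀ z → X z → Y z

  _≐_ : Subset → Subset → Set (c ⊔ ℓ)
  X ≐ Y = X ⊆ Y × Y ⊆ X

  -- order ideals (down-sets): the elements of L(P)
  IsIdeal : Subset → Set (c ⊔ ℓ)
  IsIdeal X = ∀ {x y} → x ≤ y → X y → X x

  ↓ : Carrier → Subset
  ↓ a = λ z → Lift-≤ z a
    where
    Lift-≤ : Carrier → Carrier → Set (c ⊔ ℓ)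
    Lift-≤ x y = Level.Lift c (x ≤ y)

  _\\_ : Subset → Subset → Subset
  X \\ Y = λ z → ∀ x → X x → Y (x ∙ z)

  _//_ : Subset → Subset → Subset
  Y // X = λ z → ∀ x → X x → Y (z ∙ x)

  -- "the ideal X is (identified with) an element of D ⊆ P": X = ↓d for some d ∈ D
  _∈P_ : Subset → Subset → Set (c ⊔ ℓ)
  X ∈P D = Σ[ d ∈ Carrier ] (D d × X ≐ ↓ d)

  -- intersection of a set X ⊆ P of elements viewed as ideals: ⋂ {↓x | x ∈ X}
  -- (for X = ∅ this is all of P)
  ⋂ : Subset → Subset
  ⋂ X = λ z → ∀ x → X x → z ≤ x

  -- D̄ = {⋂X | X ⊆ D}, as a set of elements of L(P) (up to extensional equality)
  closure : Subset → (Subset → Set (suc (c ⊔ ℓ)))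
  closure D Y = Σ[ X ∈ Subset ] (X ⊆ D × Y ≐ ⋂ X)

  IsNucleusSystem : (Subset → Set (suc (c ⊔ ℓ))) → Set (suc (c ⊔ ℓ))
  IsNucleusSystem C =
      (∀ Y → C Y → IsIdeal Y)
    × (∀ X → IsIdeal X →
         Σ[ M ∈ Subset ] (C M × X ⊆ M × (∀ M' → C M' → X ⊆ M' → M ⊆ M')))
    × (∀ X A → IsIdeal X → C A → C (X \\ A) × C (A // X))

-- A set ⋂Y with Y ⊆ D is determined by the inequalities z ≤ y (y ∈ Y), so
-- X \ ⋂Y consists of the z with x z ≤ y for all x ∈ X, y ∈ Y.  Each single
-- condition x z ≤ y says z ∈ ↓x \ ↓y, which by hypothesis is ↓d for some
-- d ∈ D; hence X \ ⋂Y is again an intersection of elements of D.  The right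
-- residual is the left residual of the opposite monoid.  The least element
-- of D̄ above X is ⋂ {d ∈ D | X ⊆ ↓d}.
module Submission where

open import Defs
open import Level using (Level; lift; lower)
open import Data.Product using (Σ; Σ-syntax; _×_; _,_; proj₁; proj₂)
open import Function.Base using (flip)
open import Relation.Binary.Structures using (IsPartialOrder)
import Algebra.Construct.Flip.Op as Flip

opposite : ∀ {c ℓ} → Pomonoid c ℓ → Pomonoid c ℓ
opposite P = record
  { Carrier        = Carrier
  ; _≤_            = _≤_
  ; _∙_            = flip _∙_
  ; ε              = ε
  ; isPartialOrder = isPartialOrder
  ; isMonoid       = Flip.isMonoid isMonoid
  ; ∙-monoˡ        = ∙-monoʳ
  ; ∙-monoʳ        = ∙-monoˡ
  }
  where open Pomonoid P

module ClosureSystem {c ℓ : Level} (P : Pomonoid c ℓ) where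
  open Pomonoid P
  open LP P
  open IsPartialOrder isPartialOrder using (refl; trans)

  ⋂-isIdeal : ∀ X → IsIdeal (⋂ X)
  ⋂-isIdeal X x≤y y∈⋂X d Xd = trans x≤y (y∈⋂X d Xd)

  closure⇒isIdeal : ∀ D Y → closure D Y → IsIdeal Y
  closure⇒isIdeal D Y (X , _ , Y⊆⋂X , ⋂X⊆Y) x≤y Yy =
    ⋂X⊆Y _ (⋂-isIdeal X x≤y (Y⊆⋂X _ Yy))

  UpperBoundsIn : Subset → Subset → Subset
  UpperBoundsIn D X d = D d × X ⊆ ↓ d

  γ : Subset → Subset → Subset
  γ D X = ⋂ (UpperBoundsIn D X)

  γ-closure : ∀ D X → closure D (γ D X)
  γ-closure D X = UpperBoundsIn D X , (λ _ → proj₁) , (λ _ z∈ → z∈) , (λ _ z∈ → z∈)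

  γ-extensive : ∀ D X → X ⊆ γ D X
  γ-extensive D X z Xz d (_ , X⊆↓d) = lower (X⊆↓d z Xz)

  γ-least : ∀ D X M → closure D M → X ⊆ M → γ D X ⊆ M
  γ-least D X M (Y , Y⊆D , M⊆⋂Y , ⋂Y⊆M) X⊆M z z∈γX =
    ⋂Y⊆M z λ y Yy → z∈γX y (Y⊆D y Yy , λ u Xu → lift (M⊆⋂Y u (X⊆M u Xu) y Yy))

  ≤⇒∈↓\\↓ : ∀ {x y z} → x ∙ z ≤ y → (↓ x \\ ↓ y) z
  ≤⇒∈↓\\↓ {x} {y} {z} xz≤y x' x'≤x = lift (trans (∙-monoˡ z (lower x'≤x)) xz≤y)

  ∈↓\\↓⇒≤ : ∀ {x y z} → (↓ x \\ ↓ y) z → x ∙ z ≤ y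
  ∈↓\\↓⇒≤ {x} z∈ = lower (z∈ x (lift refl))

  LeftResidualsIn : Subset → Subset → Subset → Subset
  LeftResidualsIn D X Y d =
    Σ[ x ∈ Carrier ] Σ[ y ∈ Carrier ] X x × Y y × D d × (↓ x \\ ↓ y) ≐ ↓ d

  \\-closure : ∀ D → (∀ a b → D b → (↓ a \\ ↓ b) ∈P D) →
               ∀ X A → closure D A → closure D (X \\ A)
  \\-closure D residual∈D X A (Y , Y⊆D , A⊆⋂Y , ⋂Y⊆A) =
    LeftResidualsIn D X Y , (λ { _ (_ , _ , _ , _ , Dd , _) → Dd }) , sound , complete
    where
    sound : (X \\ A) ⊆ ⋂ (LeftResidualsIn D X Y)
    sound z z∈ d (x , y , Xx , Yy , _ , ↓x\\↓y⊆↓d , _) =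
      lower (↓x\\↓y⊆↓d z (≤⇒∈↓\\↓ (A⊆⋂Y _ (z∈ x Xx) y Yy)))

    complete : ⋂ (LeftResidualsIn D X Y) ⊆ (X \\ A)
    complete z z∈ x Xx = ⋂Y⊆A _ λ y Yy →
      let (d , Dd , ↓x\\↓y≐↓d) = residual∈D x y (Y⊆D y Yy)
      in ∈↓\\↓⇒≤ (proj₂ ↓x\\↓y≐↓d z (lift (z∈ d (x , y , Xx , Yy , Dd , ↓x\\↓y≐↓d))))

lemma5p10 : ∀ {c ℓ : Level} (P : Pomonoid c ℓ) → IsIntegral P →
    (D : LP.Subset P) → Σ (Pomonoid.Carrier P) D →
    (∀ a b → D b → (LP._∈P_ P (LP._\\_ P (LP.↓ P a) (LP.↓ P b)) D)
    × (LP._∈P_ P (LP._//_ P (LP.↓ P b) (LP.↓ P a)) D)) →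
    LP.IsNucleusSystem P (LP.closure P D)
lemma5p10 P _ D _ residuals∈D =
    closure⇒isIdeal D
  , (λ X _ → γ D X , γ-closure D X , γ-extensive D X , γ-least D X)
  , λ X A _ A∈D̄ →
        \\-closure D (λ a b Db → proj₁ (residuals∈D a b Db)) X A A∈D̄
      , Opposite.\\-closure D (λ a b Db → proj₂ (residuals∈D a b Db)) X A A∈D̄
  where
  open ClosureSystem P
  module Opposite = ClosureSystem (opposite P)
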